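{- There is an absolute constant $C$ such that for every integer $i\ge0$, every $\alpha_i$-metric graph is $\delta$-hyperbolic for some $\delta\le C(i+1)$; that is, $\delta=O(i)$.
   Context: All graphs are finite, undirected, unweighted, simple and connected; $d$ is the shortest-path distance, $I(u,v)=\{z : d(u,v)=d(u,z)+d(z,v)\}$. A graph is $\alpha_i$-metric if for all vertices $u,v,w,x$ with $v\in I(u,w)$, $w\in I(v,x)$ and $v,w$ adjacent, $d(u,x)\ge d(u,v)+d(v,x)-i$. A graph is $\delta$-hyperbolic if for all vertices $u,v,w,x$ with $d(u,v)+d(w,x)\le d(u,w)+d(v,x)\le d(u,x)+d(v,w)$ one has $d(u,x)+d(v,w)-d(u,w)-d(v,x)\le 2\delta$. -}

module Defs where

open import Data.Nat using (ℕ; zero; suc; _+_; _≤_)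
open import Data.Fin using (Fin)
open import Data.Product using (Σ; _×_)
open import Relation.Binary.PropositionalEquality using (_≡_)
open import Relation.Nullary using (¬_)

data Walk {n : ℕ} (Adj : Fin n → Fin n → Set) : Fin n → Fin n → ℕ → Set where
  here : ∀ {u} → Walk Adj u u 0
  step : ∀ {u w v k} → Adj u w → Walk Adj w v k → Walk Adj u v (suc k)

record Graph : Set₁ where
  field
    n         : ℕ
    Adj       : Fin n → Fin n → Set
    sym       : ∀ {u v} → Adj u v → Adj v u
    irrefl    : ∀ {u} → ¬ Adj u u
    connected : ∀ u v → Σ ℕ (λ k → Walk Adj u v k)

module _ (G : Graph) where
  open Graph G

  Dist : Fin n → Fin n → ℕ → Set
  Dist u v k = Walk Adj u v k × (∀ m → Walk Adj u v m → k ≤ m)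

-- α_i-metric: v ∈ I(u,w), w ∈ I(v,x), v ~ w  ⇒  d(u,x) ≥ d(u,v) + d(v,x) - i.
AlphaMetric : ℕ → Graph → Set
AlphaMetric i G =
  ∀ (u v w x : Fin (Graph.n G)) {duv dvw duw dvx dwx dux : ℕ} →
  Dist G u v duv → Dist G v w dvw → Dist G u w duw →
  Dist G v x dvx → Dist G w x dwx → Dist G u x dux →
  Graph.Adj G v w →
  duw ≡ duv + dvw →
  dvx ≡ dvw + dwx →
  duv + dvx ≤ dux + i

-- HyperbolicTwice G k : G is δ-hyperbolic with 2δ = k (four-point condition).
HyperbolicTwice : Graph → ℕ → Set
HyperbolicTwice G k =
  ∀ (u v w x : Fin (Graph.n G)) {duv dwx duw dvx dux dvw : ℕ} →
  Dist G u v duv → Dist G w x dwx → Dist G u w duw →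
  Dist G v x dvx → Dist G u x dux → Dist G v w dvw →
  duv + dwx ≤ duw + dvx →
  duw + dvx ≤ dux + dvw →
  dux + dvw ≤ duw + dvx + k

-- Fix u and an interval I(a,b), and let m be a vertex of I(a,b) nearest to u. Along a geodesic from m
-- to b the distance to u first stays at its minimum (a plateau of some length ℓ); where it first
-- increases, the α_i-condition gives d(u,m) + d(m,b) ≤ d(u,b) + i + ℓ. Plateaus of length i + 1 on both
-- sides of a vertex z are impossible: α_i then places the neighbour of z towards u inside I(a,b),
-- closer to u than the minimum. Hence d(u,m) + d(m,b) ≤ d(u,b) + 3i + 2, and likewise for a. These
-- nearest points, together with the α_i-condition along a geodesic on which the distance to a vertex
-- increases, show that two vertices of I(a,b) at equal distance from a are at distance ≤ 2(3i + 2).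
-- Comparing the nearest points of u and of x in I(v,w) then yields the four-point condition with
-- 2δ = 4(3i + 2) ≤ 16(i + 1). Shortest-path distances exist only classically (adjacency need not be
-- decidable), but the conclusion is a decidable inequality, so the argument may run under double negation.

module Submission where

open import Defs
open import Data.Nat using (ℕ; _+_; _*_; _≤_)
open import Data.Product using (Σ; _×_)

open import Data.Nat using (suc; zero; _<_; _≟_; _≤?_)
open import Data.Nat.Properties
open import Data.Nat.Induction using (<-rec)
open import Data.Nat.Tactic.RingSolver using (solve)
open import Data.Fin using (Fin)
import Data.Fin as Fin
open import Data.List using (List; _∷_; []; filter; allFin)
open import Data.List.Extrema.Nat using (argmin; argmin-all; f[argmin]≤f[xs])
open import Data.List.Membership.Propositional.Properties using (∈-allFin; ∈-filter⁺)
open import Data.List.Relation.Unary.All using (lookup)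
open import Data.List.Relation.Unary.All.Properties using (all-filter)
open import Data.Product using (_,_; proj₁; proj₂)
open import Data.Sum using (_⊎_; inj₁; inj₂; [_,_]′)
open import Data.Empty using (⊥; ⊥-elim)
open import Function using (_∘_)
open import Relation.Nullary using (¬_; yes; no)
open import Relation.Nullary.Decidable using (decidable-stable; ¬¬-excluded-middle)
open import Relation.Nullary.Negation using (¬¬-map)
open import Relation.Unary using (Decidable)
open import Relation.Binary.PropositionalEquality using (_≡_; _≢_; refl; sym; trans; cong; cong₂)
open import Algebra.Properties.CommutativeSemigroup +-commutativeSemigroup
  using (x∙yz≈y∙xz; xy∙z≈xz∙y)

¬¬-shift-Fin : ∀ {n} {P : Fin n → Set} → (∀ x → ¬ ¬ P x) → ¬ ¬ (∀ x → P x)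
¬¬-shift-Fin {zero}  _   ¬∀P = ¬∀P λ ()
¬¬-shift-Fin {suc n} ¬¬P ¬∀P =
  ¬¬P Fin.zero λ P0 → ¬¬-shift-Fin (¬¬P ∘ Fin.suc) λ Psuc → ¬∀P λ where
    Fin.zero    → P0
    (Fin.suc x) → Psuc x

argmin-Fin : ∀ {n} {P : Fin n → Set} → Decidable P → (f : Fin n → ℕ) → ∀ {a} → P a →
             Σ (Fin n) λ m → P m × (∀ w → P w → f m ≤ f w)
argmin-Fin {n} P? f {a} Pa =
  argmin f a ws , argmin-all f Pa (all-filter P? (allFin n)) ,
  λ w Pw → lookup (f[argmin]≤f[xs] a ws) (∈-filter⁺ P? (∈-allFin w) Pw)
  where
  ws : List (Fin n)
  ws = filter P? (allFin n)

record GeodesicMetric (X : Set) : Set where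
  field
    d          : X → X → ℕ
    d-refl     : ∀ a → d a a ≡ 0
    d-sym      : ∀ a b → d a b ≡ d b a
    d-triangle : ∀ a b c → d a c ≤ d a b + d b c
    d-step     : ∀ {a b k} → d a b ≡ suc k → Σ X λ a′ → d a a′ ≡ 1 × d a′ b ≡ k

module Intervals {X : Set} (M : GeodesicMetric X) where
  open GeodesicMetric M
  open ≤-Reasoning

  _∈[_,_] : X → X → X → Set
  z ∈[ a , b ] = d a z + d z b ≡ d a b

  ∈[]-intro : ∀ {a b z} → d a z + d z b ≤ d a b → z ∈[ a , b ]
  ∈[]-intro {a} {b} {z} le = ≤-antisym le (d-triangle a z b)

  ∈[]-sym : ∀ {a b z} → z ∈[ a , b ] → z ∈[ b , a ]
  ∈[]-sym {a} {b} {z} z∈ = begin-equality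
    d b z + d z a  ≡⟨ cong₂ _+_ (d-sym b z) (d-sym z a) ⟩
    d z b + d a z  ≡⟨ +-comm (d z b) (d a z) ⟩
    d a z + d z b  ≡⟨ z∈ ⟩
    d a b          ≡⟨ d-sym a b ⟩
    d b a          ∎

  start∈[] : ∀ {a b} → a ∈[ a , b ]
  start∈[] {a} {b} = cong (_+ d a b) (d-refl a)

  end∈[] : ∀ {a b} → b ∈[ a , b ]
  end∈[] {a} {b} = trans (cong (d a b +_) (d-refl b)) (+-identityʳ (d a b))

  ∈[]-narrowˡ : ∀ {a b z w} → z ∈[ a , b ] → w ∈[ z , b ] → w ∈[ a , b ]
  ∈[]-narrowˡ {a} {b} {z} {w} z∈ w∈ = ∈[]-intro (begin
    d a w + d w b          ≤⟨ +-monoˡ-≤ (d w b) (d-triangle a z w) ⟩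
    d a z + d z w + d w b  ≡⟨ +-assoc (d a z) (d z w) (d w b) ⟩
    d a z + (d z w + d w b) ≡⟨ cong (d a z +_) w∈ ⟩
    d a z + d z b          ≡⟨ z∈ ⟩
    d a b                  ∎)

  ∈[]-splitˡ : ∀ {a b z w} → z ∈[ a , b ] → w ∈[ z , b ] → z ∈[ a , w ]
  ∈[]-splitˡ {a} {b} {z} {w} z∈ w∈ = ∈[]-intro (+-cancelʳ-≤ (d w b) _ _ (begin
    d a z + d z w + d w b   ≡⟨ +-assoc (d a z) (d z w) (d w b) ⟩
    d a z + (d z w + d w b) ≡⟨ cong (d a z +_) w∈ ⟩
    d a z + d z b           ≡⟨ z∈ ⟩
    d a b                   ≡⟨ ∈[]-narrowˡ z∈ w∈ ⟨
    d a w + d w b           ∎))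

  ∈[]-narrowʳ : ∀ {a b z w} → z ∈[ a , b ] → w ∈[ a , z ] → w ∈[ a , b ]
  ∈[]-narrowʳ z∈ w∈ = ∈[]-sym (∈[]-narrowˡ (∈[]-sym z∈) (∈[]-sym w∈))

  ∈[]-splitʳ : ∀ {a b z w} → z ∈[ a , b ] → w ∈[ a , z ] → z ∈[ w , b ]
  ∈[]-splitʳ z∈ w∈ = ∈[]-sym (∈[]-splitˡ (∈[]-sym z∈) (∈[]-sym w∈))

  ∈[]-≤-flip : ∀ {a b z w} → z ∈[ a , b ] → w ∈[ a , b ] → d a z ≤ d a w → d b w ≤ d b z
  ∈[]-≤-flip {a} {b} {z} {w} z∈ w∈ az≤aw = +-cancelˡ-≤ (d a z) _ _ (begin
    d a z + d b w  ≤⟨ +-monoˡ-≤ (d b w) az≤aw ⟩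
    d a w + d b w  ≡⟨ cong (d a w +_) (d-sym b w) ⟩
    d a w + d w b  ≡⟨ trans w∈ (sym z∈) ⟩
    d a z + d z b  ≡⟨ cong (d a z +_) (d-sym z b) ⟩
    d a z + d b z  ∎)

  step-∈[] : ∀ {a b} → d a b ≢ 0 → Σ X λ a′ → d a a′ ≡ 1 × a′ ∈[ a , b ]
  step-∈[] {a} {b} ab≢0 with d a b in eq
  ... | zero  = ⊥-elim (ab≢0 refl)
  ... | suc k with d-step eq
  ...   | a′ , aa′≡1 , a′b≡k = a′ , aa′≡1 , cong₂ _+_ aa′≡1 a′b≡k

  ∈[]-after-step : ∀ {a b a′} → d a a′ ≡ 1 → a′ ∈[ a , b ] → d a b ≡ suc (d a′ b)
  ∈[]-after-step {a} {b} {a′} aa′≡1 a′∈ = trans (sym a′∈) (cong (_+ d a′ b) aa′≡1)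

  geodesic-point : ∀ {a b} k → k ≤ d a b → Σ X λ p → d a p ≡ k × p ∈[ a , b ]
  geodesic-point {a} zero _ = a , d-refl a , start∈[]
  geodesic-point (suc k) k<ab with step-∈[] (m<n⇒n≢0 k<ab)
  ... | a′ , aa′≡1 , a′∈ with geodesic-point k (≤-pred (≤-trans k<ab (≤-reflexive (∈[]-after-step aa′≡1 a′∈))))
  ...   | p , a′p≡k , p∈ =
    p , trans (sym (∈[]-splitˡ a′∈ p∈)) (cong₂ _+_ aa′≡1 a′p≡k) , ∈[]-narrowˡ a′∈ p∈

  neighbour-dist : ∀ {u z z′} → d z z′ ≡ 1 → d u z′ ≤ d u z ⊎ d u z′ ≡ d u z + 1
  neighbour-dist {u} {z} {z′} zz′≡1 with d u z′ ≤? d u z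
  ... | yes le = inj₁ le
  ... | no  gt = inj₂ (≤-antisym
    (≤-trans (d-triangle u z z′) (≤-reflexive (cong (d u z +_) zz′≡1)))
    (≤-trans (≤-reflexive (+-comm (d u z) 1)) (≰⇒> gt)))

  ∈[]-shift : ∀ {u z z′ b} → z′ ∈[ z , b ] → d u z ≡ d u z′ → d u z + d z b ≡ d z z′ + (d u z′ + d z′ b)
  ∈[]-shift {u} {z} {z′} {b} z′∈ uz≡uz′ = begin-equality
    d u z + d z b              ≡⟨ cong₂ _+_ uz≡uz′ (sym z′∈) ⟩
    d u z′ + (d z z′ + d z′ b) ≡⟨ x∙yz≈y∙xz (d u z′) (d z z′) (d z′ b) ⟩
    d z z′ + (d u z′ + d z′ b) ∎

  Nearest : X → X → X → X → Set
  Nearest u a b m = m ∈[ a , b ] × (∀ w → w ∈[ a , b ] → d u m ≤ d u w)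

  nearest-sym : ∀ {u a b m} → Nearest u a b m → Nearest u b a m
  nearest-sym (m∈ , m-min) = ∈[]-sym m∈ , λ w → m-min w ∘ ∈[]-sym

  nearest-dist : ∀ {u a b m m′} → Nearest u a b m → Nearest u a b m′ → d u m ≡ d u m′
  nearest-dist (m∈ , m-min) (m′∈ , m′-min) = ≤-antisym (m-min _ m′∈) (m′-min _ m∈)

nearest-Fin : ∀ {n} (M : GeodesicMetric (Fin n)) → ∀ u a b → Σ (Fin n) (Intervals.Nearest M u a b)
nearest-Fin M u a b = argmin-Fin (λ w → d a w + d w b ≟ d a b) (d u) start∈[]
  where
  open GeodesicMetric M
  open Intervals M

AlphaCondition : ∀ {X} → GeodesicMetric X → ℕ → Set
AlphaCondition M i =
  ∀ u v w x → d v w ≡ 1 → d u w ≡ d u v + 1 → d v x ≡ 1 + d w x → d u v + d v x ≤ d u x + i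
  where open GeodesicMetric M

-- The error in nearest-bound: two plateaus of length at most i + 1, plus the i lost in the α_i-condition.
slack : ℕ → ℕ
slack i = 3 * i + 2

module AlphaGeometry {X : Set} (M : GeodesicMetric X) (i : ℕ) (α : AlphaCondition M i) where
  open GeodesicMetric M
  open Intervals M
  open ≤-Reasoning

  slack-identity : ∀ x → suc i + (x + i + suc i) ≡ x + (3 * i + 2)
  slack-identity x = solve (x ∷ i ∷ [])

  α-step : ∀ {u z z′ b} → d z z′ ≡ 1 → z′ ∈[ z , b ] → d u z′ ≡ d u z + 1 → d u z + d z b ≤ d u b + i
  α-step {u} {z} {z′} {b} zz′≡1 z′∈ up = α u z z′ b zz′≡1 up (∈[]-after-step zz′≡1 z′∈)

  plateau-step : ∀ {u a b z} → Nearest u a b z →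
                 d u z + d z b ≤ d u b + i ⊎ Σ X λ z′ → d z z′ ≡ 1 × z′ ∈[ z , b ] × Nearest u a b z′
  plateau-step {u} {a} {b} {z} (z∈ , z-min) with d z b ≟ 0
  ... | yes zb≡0 = inj₁ (begin
    d u z + d z b  ≡⟨ cong (d u z +_) zb≡0 ⟩
    d u z + 0      ≡⟨ +-identityʳ (d u z) ⟩
    d u z          ≤⟨ z-min b end∈[] ⟩
    d u b          ≤⟨ m≤m+n (d u b) i ⟩
    d u b + i      ∎)
  ... | no zb≢0 with step-∈[] zb≢0
  ...   | z′ , zz′≡1 , z′∈ with neighbour-dist {u} zz′≡1
  ...     | inj₂ up = inj₁ (α-step zz′≡1 z′∈ up)
  ...     | inj₁ le = inj₂ (z′ , zz′≡1 , z′∈ , ∈[]-narrowˡ z∈ z′∈ , λ w w∈ → ≤-trans le (z-min w w∈))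

  plateau : ∀ {u a b z} → Nearest u a b z → ∀ k →
            d u z + d z b ≤ d u b + i + k ⊎ Σ X λ z′ → d z z′ ≡ k × z′ ∈[ z , b ] × Nearest u a b z′
  plateau {z = z} z-near zero = inj₂ (z , d-refl z , start∈[] , z-near)
  plateau {u} {a} {b} {z} z-near (suc k) with plateau z-near k
  ... | inj₁ le = inj₁ (≤-trans le (+-monoʳ-≤ (d u b + i) (n≤1+n k)))
  ... | inj₂ (z′ , zz′≡k , z′∈ , z′-near) with plateau-step z′-near
  ...   | inj₁ le = inj₁ (begin
    d u z + d z b              ≡⟨ ∈[]-shift z′∈ (nearest-dist z-near z′-near) ⟩
    d z z′ + (d u z′ + d z′ b) ≤⟨ +-mono-≤ (≤-reflexive zz′≡k) le ⟩
    k + (d u b + i)            ≡⟨ +-comm k (d u b + i) ⟩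
    d u b + i + k              ≤⟨ +-monoʳ-≤ (d u b + i) (n≤1+n k) ⟩
    d u b + i + suc k          ∎)
  ...   | inj₂ (z″ , z′z″≡1 , z″∈ , z″-near) =
    inj₂ (z″ , zz″≡1+k , ∈[]-narrowˡ z′∈ z″∈ , z″-near)
    where
    zz″≡1+k : d z z″ ≡ suc k
    zz″≡1+k = begin-equality
      d z z″           ≡⟨ ∈[]-splitˡ z′∈ z″∈ ⟨
      d z z′ + d z′ z″ ≡⟨ cong₂ _+_ zz′≡k z′z″≡1 ⟩
      k + 1            ≡⟨ +-comm k 1 ⟩
      suc k            ∎

  α-descent : ∀ {u c z e} → d c z ≡ 1 → d u z ≡ d u c + 1 → d u e ≤ d u z → i < d z e → d c e ≤ d z e
  α-descent {u} {c} {z} {e} cz≡1 up ue≤uz i<ze with neighbour-dist {e} (trans (d-sym z c) cz≡1)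
  ... | inj₁ ec≤ez = begin
    d c e  ≡⟨ d-sym c e ⟩
    d e c  ≤⟨ ec≤ez ⟩
    d e z  ≡⟨ d-sym e z ⟩
    d z e  ∎
  ... | inj₂ ec≡ez+1 = ⊥-elim (<⇒≱ i<ze (+-cancelˡ-≤ (d u c + 1) _ _ (begin
    d u c + 1 + d z e    ≡⟨ +-assoc (d u c) 1 (d z e) ⟩
    d u c + (1 + d z e)  ≡⟨ cong (d u c +_) ce≡1+ze ⟨
    d u c + d c e        ≤⟨ α u c z e cz≡1 up ce≡1+ze ⟩
    d u e + i            ≤⟨ +-monoˡ-≤ i ue≤uz ⟩
    d u z + i            ≡⟨ cong (_+ i) up ⟩
    d u c + 1 + i        ∎)))
    where
    ce≡1+ze : d c e ≡ 1 + d z e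
    ce≡1+ze = begin-equality
      d c e      ≡⟨ d-sym c e ⟩
      d e c      ≡⟨ ec≡ez+1 ⟩
      d e z + 1  ≡⟨ cong (_+ 1) (d-sym e z) ⟩
      d z e + 1  ≡⟨ +-comm (d z e) 1 ⟩
      1 + d z e  ∎

  α-bridge : ∀ {u a b z c e₁ e₂} → z ∈[ a , b ] → d c z ≡ 1 → d u z ≡ d u c + 1 →
             e₁ ∈[ a , z ] → i < d e₁ z → d u e₁ ≤ d u z →
             e₂ ∈[ z , b ] → i < d z e₂ → d u e₂ ≤ d u z → c ∈[ a , b ]
  α-bridge {u} {a} {b} {z} {c} {e₁} {e₂} z∈ cz≡1 up e₁∈ i<e₁z ue₁≤uz e₂∈ i<ze₂ ue₂≤uz = ∈[]-intro (begin
    d a c + d c b                         ≤⟨ +-mono-≤ (d-triangle a e₁ c) (d-triangle c e₂ b) ⟩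
    d a e₁ + d e₁ c + (d c e₂ + d e₂ b)   ≤⟨ +-mono-≤ (+-monoʳ-≤ (d a e₁) e₁c≤e₁z) (+-monoˡ-≤ (d e₂ b) ce₂≤ze₂) ⟩
    d a e₁ + d e₁ z + (d z e₂ + d e₂ b)   ≡⟨ cong₂ _+_ e₁∈ e₂∈ ⟩
    d a z + d z b                         ≡⟨ z∈ ⟩
    d a b                                 ∎)
    where
    e₁c≤e₁z : d e₁ c ≤ d e₁ z
    e₁c≤e₁z = begin
      d e₁ c  ≡⟨ d-sym e₁ c ⟩
      d c e₁  ≤⟨ α-descent cz≡1 up ue₁≤uz (≤-trans i<e₁z (≤-reflexive (d-sym e₁ z))) ⟩
      d z e₁  ≡⟨ d-sym z e₁ ⟩
      d e₁ z  ∎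
    ce₂≤ze₂ : d c e₂ ≤ d z e₂
    ce₂≤ze₂ = α-descent cz≡1 up ue₂≤uz i<ze₂

  no-long-plateau : ∀ {u a b z e₁ e₂} → Nearest u a b z →
                    e₁ ∈[ a , z ] → i < d e₁ z → Nearest u a b e₁ →
                    e₂ ∈[ z , b ] → i < d z e₂ → Nearest u a b e₂ → ⊥
  no-long-plateau {u} {a} {b} {z} {e₁} z-near e₁∈ i<e₁z e₁-near e₂∈ i<ze₂ e₂-near with d z u ≟ 0
  ... | yes zu≡0 = n≮0 (begin-strict
    i               <⟨ i<e₁z ⟩
    d e₁ z          ≤⟨ d-triangle e₁ u z ⟩
    d e₁ u + d u z  ≡⟨ cong₂ _+_ (trans (d-sym e₁ u) (trans (nearest-dist e₁-near z-near) uz≡0)) uz≡0 ⟩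
    0               ∎)
    where
    uz≡0 : d u z ≡ 0
    uz≡0 = trans (d-sym u z) zu≡0
  ... | no zu≢0 with step-∈[] zu≢0
  ...   | c , zc≡1 , c∈ = 1+n≰n (begin
    1 + d u c  ≡⟨ +-comm 1 (d u c) ⟩
    d u c + 1  ≡⟨ up ⟨
    d u z      ≤⟨ proj₂ z-near c (α-bridge (proj₁ z-near) (trans (d-sym c z) zc≡1) up
                    e₁∈ i<e₁z (≤-reflexive (nearest-dist e₁-near z-near))
                    e₂∈ i<ze₂ (≤-reflexive (nearest-dist e₂-near z-near))) ⟩
    d u c      ∎)
    where
    up : d u z ≡ d u c + 1
    up = begin-equality
      d u z      ≡⟨ d-sym u z ⟩
      d z u      ≡⟨ ∈[]-after-step zc≡1 c∈ ⟩
      suc (d c u) ≡⟨ cong suc (d-sym c u) ⟩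
      suc (d u c) ≡⟨ +-comm 1 (d u c) ⟩
      d u c + 1  ∎

  nearest-bound : ∀ {u a b m} → Nearest u a b m → d u m + d m b ≤ d u b + slack i
  nearest-bound {u} {a} {b} {m} m-near with plateau m-near (suc i)
  ... | inj₁ le = begin
    d u m + d m b                ≤⟨ le ⟩
    d u b + i + suc i            ≤⟨ m≤n+m (d u b + i + suc i) (suc i) ⟩
    suc i + (d u b + i + suc i)  ≡⟨ slack-identity (d u b) ⟩
    d u b + slack i              ∎
  ... | inj₂ (z , mz≡1+i , z∈ , z-near) with plateau z-near (suc i)
  ...   | inj₁ le = begin
    d u m + d m b                ≡⟨ ∈[]-shift z∈ (nearest-dist m-near z-near) ⟩
    d m z + (d u z + d z b)      ≤⟨ +-mono-≤ (≤-reflexive mz≡1+i) le ⟩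
    suc i + (d u b + i + suc i)  ≡⟨ slack-identity (d u b) ⟩
    d u b + slack i              ∎
  ...   | inj₂ (z′ , zz′≡1+i , z′∈ , z′-near) = ⊥-elim (no-long-plateau z-near
    (∈[]-splitˡ (proj₁ m-near) z∈) (≤-reflexive (sym mz≡1+i)) m-near
    z′∈ (≤-reflexive (sym zz′≡1+i)) z′-near)

  α-after-increase : ∀ {y p z q} → z ∈[ p , q ] → d y p < d y z → d y z + d z q ≤ d y q + i
  α-after-increase = go _ refl
    where
    go : ∀ {y p z q} k → d p z ≡ k → z ∈[ p , q ] → d y p < d y z → d y z + d z q ≤ d y q + i
    go {y} {p} {z} zero pz≡0 _ yp<yz = ⊥-elim (<⇒≱ yp<yz (begin
      d y z          ≤⟨ d-triangle y p z ⟩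
      d y p + d p z  ≡⟨ cong (d y p +_) pz≡0 ⟩
      d y p + 0      ≡⟨ +-identityʳ (d y p) ⟩
      d y p          ∎))
    go {y} {p} {z} {q} (suc k) pz≡1+k z∈ yp<yz with step-∈[] (λ pz≡0 → 1+n≢0 (trans (sym pz≡1+k) pz≡0))
    ... | p′ , pp′≡1 , p′∈ with neighbour-dist {y} pp′≡1
    ...   | inj₁ yp′≤yp = go k (suc-injective (trans (sym (∈[]-after-step pp′≡1 p′∈)) pz≡1+k))
                            (∈[]-splitʳ z∈ p′∈) (≤-<-trans yp′≤yp yp<yz)
    ...   | inj₂ up = begin
      d y z + d z q            ≤⟨ +-monoˡ-≤ (d z q) (d-triangle y p z) ⟩
      d y p + d p z + d z q    ≡⟨ +-assoc (d y p) (d p z) (d z q) ⟩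
      d y p + (d p z + d z q)  ≡⟨ cong (d y p +_) z∈ ⟩
      d y p + d p q            ≤⟨ α-step pp′≡1 (∈[]-narrowʳ z∈ p′∈) up ⟩
      d y q + i                ∎

  module _ (nearest : ∀ u a b → Σ X (Nearest u a b)) where

    interval-thin : ∀ {a b y z} → y ∈[ a , b ] → z ∈[ a , b ] → d a y ≡ d a z → d y z ≤ slack i + slack i
    interval-thin {a} {b} {y} {z} y∈ z∈ ay≡az = [ via-r , via-increase ]′ (≤-<-connex (d y z) (d y r))
      where
      q : X
      q = proj₁ (nearest y z b)
      q-near : Nearest y z b q
      q-near = proj₂ (nearest y z b)
      r : X
      r = proj₁ (nearest y a z)
      r-near : Nearest y a z r
      r-near = proj₂ (nearest y a z)

      yb≡zb : d y b ≡ d z b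
      yb≡zb = +-cancelˡ-≡ (d a y) _ _ (trans y∈ (trans (sym z∈) (cong (_+ d z b) (sym ay≡az))))

      yq≤zq+slack : d y q ≤ d z q + slack i
      yq≤zq+slack = +-cancelʳ-≤ (d q b) _ _ (begin
        d y q + d q b            ≤⟨ nearest-bound q-near ⟩
        d y b + slack i          ≡⟨ cong (_+ slack i) (trans yb≡zb (sym (proj₁ q-near))) ⟩
        d z q + d q b + slack i  ≡⟨ xy∙z≈xz∙y (d z q) (d q b) (slack i) ⟩
        d z q + slack i + d q b  ∎)

      via-increase : d y r < d y z → d y z ≤ slack i + slack i
      via-increase yr<yz = +-cancelˡ-≤ (d z q) _ _ (begin
        d z q + d y z              ≡⟨ +-comm (d z q) (d y z) ⟩
        d y z + d z q              ≤⟨ α-after-increase (∈[]-splitʳ (∈[]-splitˡ z∈ (proj₁ q-near)) (proj₁ r-near)) yr<yz ⟩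
        d y q + i                  ≤⟨ +-mono-≤ yq≤zq+slack (≤-trans (m≤m+n i (2 * i)) (m≤m+n (3 * i) 2)) ⟩
        d z q + slack i + slack i  ≡⟨ +-assoc (d z q) (slack i) (slack i) ⟩
        d z q + (slack i + slack i) ∎)

      via-r : d y z ≤ d y r → d y z ≤ slack i + slack i
      via-r yz≤yr = begin
        d y z            ≤⟨ yz≤yr ⟩
        d y r            ≤⟨ yr≤rz+slack ⟩
        d r z + slack i  ≤⟨ +-monoˡ-≤ (slack i) rz≤slack ⟩
        slack i + slack i ∎
        where
        rz≤slack : d r z ≤ slack i
        rz≤slack = +-cancelˡ-≤ (d y r) _ _ (begin
          d y r + d r z    ≤⟨ nearest-bound r-near ⟩
          d y z + slack i  ≤⟨ +-monoˡ-≤ (slack i) yz≤yr ⟩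
          d y r + slack i  ∎)
        yr≤rz+slack : d y r ≤ d r z + slack i
        yr≤rz+slack = +-cancelʳ-≤ (d r a) _ _ (begin
          d y r + d r a            ≤⟨ nearest-bound (nearest-sym r-near) ⟩
          d y a + slack i          ≡⟨ cong (_+ slack i) ya≡ra+rz ⟩
          d r a + d r z + slack i  ≡⟨ cong (_+ slack i) (+-comm (d r a) (d r z)) ⟩
          d r z + d r a + slack i  ≡⟨ xy∙z≈xz∙y (d r z) (d r a) (slack i) ⟩
          d r z + slack i + d r a  ∎)
          where
          ya≡ra+rz : d y a ≡ d r a + d r z
          ya≡ra+rz = begin-equality
            d y a          ≡⟨ d-sym y a ⟩
            d a y          ≡⟨ ay≡az ⟩
            d a z          ≡⟨ proj₁ r-near ⟨
            d a r + d r z  ≡⟨ cong (_+ d r z) (d-sym a r) ⟩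
            d r a + d r z  ∎

    four-point-half : ∀ {u v w x m₁ m₂} → Nearest u v w m₁ → Nearest x v w m₂ → d v m₁ ≤ d v m₂ →
                      d u x + d v w ≤ d u w + d v x + 4 * slack i
    four-point-half {u} {v} {w} {x} {m₁} {m₂} m₁-near m₂-near vm₁≤vm₂ with geodesic-point {v} {m₂} (d v m₁) vm₁≤vm₂
    ... | p , vp≡vm₁ , p∈ = begin
      d u x + d v w
        ≤⟨ +-mono-≤ path (≤-reflexive vw-split) ⟩
      d u m₁ + d m₁ p + d p m₂ + d m₂ x + (d v p + d m₁ w)
        ≡⟨ regroup (d u m₁) (d m₁ p) (d p m₂) (d m₂ x) (d v p) (d m₁ w) ⟩
      d u m₁ + d m₁ w + d m₁ p + (d v p + d p m₂ + d m₂ x)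
        ≡⟨ cong (λ t → d u m₁ + d m₁ w + d m₁ p + t) x-side ⟩
      d u m₁ + d m₁ w + d m₁ p + (d x m₂ + d m₂ v)
        ≤⟨ +-mono-≤ (+-mono-≤ (nearest-bound m₁-near) thin) (nearest-bound (nearest-sym m₂-near)) ⟩
      d u w + slack i + (slack i + slack i) + (d x v + slack i)
        ≡⟨ cong (λ t → d u w + slack i + (slack i + slack i) + (t + slack i)) (d-sym x v) ⟩
      d u w + slack i + (slack i + slack i) + (d v x + slack i)
        ≡⟨ collect (d u w) (d v x) (slack i) ⟩
      d u w + d v x + 4 * slack i ∎
      where
      regroup : ∀ a b c e f g → a + b + c + e + (f + g) ≡ a + g + b + (f + c + e)
      regroup a b c e f g = solve (a ∷ b ∷ c ∷ e ∷ f ∷ g ∷ [])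
      collect : ∀ a b s → a + s + (s + s) + (b + s) ≡ a + b + 4 * s
      collect a b s = solve (a ∷ b ∷ s ∷ [])

      path : d u x ≤ d u m₁ + d m₁ p + d p m₂ + d m₂ x
      path = begin
        d u x                            ≤⟨ d-triangle u m₂ x ⟩
        d u m₂ + d m₂ x                  ≤⟨ +-monoˡ-≤ (d m₂ x) (d-triangle u p m₂) ⟩
        d u p + d p m₂ + d m₂ x          ≤⟨ +-monoˡ-≤ (d m₂ x) (+-monoˡ-≤ (d p m₂) (d-triangle u m₁ p)) ⟩
        d u m₁ + d m₁ p + d p m₂ + d m₂ x ∎

      vw-split : d v w ≡ d v p + d m₁ w
      vw-split = trans (sym (proj₁ m₁-near)) (cong (_+ d m₁ w) (sym vp≡vm₁))

      x-side : d v p + d p m₂ + d m₂ x ≡ d x m₂ + d m₂ v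
      x-side = begin-equality
        d v p + d p m₂ + d m₂ x  ≡⟨ cong (_+ d m₂ x) p∈ ⟩
        d v m₂ + d m₂ x          ≡⟨ +-comm (d v m₂) (d m₂ x) ⟩
        d m₂ x + d v m₂          ≡⟨ cong₂ _+_ (d-sym m₂ x) (d-sym v m₂) ⟩
        d x m₂ + d m₂ v          ∎

      thin : d m₁ p ≤ slack i + slack i
      thin = interval-thin (proj₁ m₁-near) (∈[]-narrowʳ (proj₁ m₂-near) p∈) (sym vp≡vm₁)

    four-point : ∀ {u v w x} → d u v + d w x ≤ d u w + d v x → d u x + d v w ≤ d u w + d v x + 4 * slack i
    four-point {u} {v} {w} {x} uv+wx≤uw+vx =
      [ four-point-half m₁-near m₂-near , swapped ]′ (≤-total (d v m₁) (d v m₂))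
      where
      m₁ : X
      m₁ = proj₁ (nearest u v w)
      m₁-near : Nearest u v w m₁
      m₁-near = proj₂ (nearest u v w)
      m₂ : X
      m₂ = proj₁ (nearest x v w)
      m₂-near : Nearest x v w m₂
      m₂-near = proj₂ (nearest x v w)

      swapped : d v m₂ ≤ d v m₁ → d u x + d v w ≤ d u w + d v x + 4 * slack i
      swapped vm₂≤vm₁ = begin
        d u x + d v w                ≡⟨ cong (d u x +_) (d-sym v w) ⟩
        d u x + d w v                ≤⟨ four-point-half (nearest-sym m₁-near) (nearest-sym m₂-near)
                                          (∈[]-≤-flip (proj₁ m₂-near) (proj₁ m₁-near) vm₂≤vm₁) ⟩
        d u v + d w x + 4 * slack i  ≤⟨ +-monoˡ-≤ (4 * slack i) uv+wx≤uw+vx ⟩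
        d u w + d v x + 4 * slack i  ∎

module ShortestPaths (G : Graph) where
  open Graph G renaming (sym to Adj-sym)

  _++ʷ_ : ∀ {u v w j k} → Walk Adj u v j → Walk Adj v w k → Walk Adj u w (j + k)
  here       ++ʷ q = q
  step uv p  ++ʷ q = step uv (p ++ʷ q)

  _∷ʳʷ_ : ∀ {u v w k} → Walk Adj u v k → Adj v w → Walk Adj u w (suc k)
  here       ∷ʳʷ vw = step vw here
  step uu′ p ∷ʳʷ vw = step uu′ (p ∷ʳʷ vw)

  reverseʷ : ∀ {u v k} → Walk Adj u v k → Walk Adj v u k
  reverseʷ here        = here
  reverseʷ (step uw p) = reverseʷ p ∷ʳʷ Adj-sym uw

  shortest-walk : ∀ {u v} k → Walk Adj u v k → ¬ ¬ Σ ℕ (Dist G u v)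
  shortest-walk {u} {v} = <-rec _ go
    where
    go : ∀ k → (∀ {j} → j < k → Walk Adj u v j → ¬ ¬ Σ ℕ (Dist G u v)) → Walk Adj u v k → ¬ ¬ Σ ℕ (Dist G u v)
    go k shorter walk no-shortest = ¬¬-excluded-middle {A = Σ ℕ λ j → j < k × Walk Adj u v j} λ where
      (yes (j , j<k , walk′)) → shorter j<k walk′ no-shortest
      (no none) → no-shortest (k , walk , λ m walk-m → ≮⇒≥ λ m<k → none (m , m<k , walk-m))

  all-distances : ¬ ¬ (∀ u v → Σ ℕ (Dist G u v))
  all-distances = ¬¬-shift-Fin λ u → ¬¬-shift-Fin λ v → shortest-walk _ (proj₂ (connected u v))

  module Table (D : ∀ u v → Σ ℕ (Dist G u v)) where
    open ≤-Reasoning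

    d : Fin n → Fin n → ℕ
    d u v = proj₁ (D u v)

    shortest : ∀ u v → Walk Adj u v (d u v)
    shortest u v = proj₁ (proj₂ (D u v))

    minimal : ∀ {u v k} → Walk Adj u v k → d u v ≤ k
    minimal = proj₂ (proj₂ (D _ _)) _

    d-unique : ∀ {u v k} → Dist G u v k → d u v ≡ k
    d-unique {u} {v} (walk , walk-min) = ≤-antisym (minimal walk) (walk-min _ (shortest u v))

    walk-of-length : ∀ {u v k} → d u v ≡ k → Walk Adj u v k
    walk-of-length {u} {v} refl = shortest u v

    adjacent : ∀ {u v} → d u v ≡ 1 → Adj u v
    adjacent uv≡1 with walk-of-length uv≡1
    ... | step uv here = uv

    distinct : ∀ {u v} → Adj u v → d u v ≢ 0
    distinct uv uv≡0 with walk-of-length uv≡0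
    ... | here = irrefl uv

    d-step : ∀ {a b k} → d a b ≡ suc k → Σ (Fin n) λ a′ → d a a′ ≡ 1 × d a′ b ≡ k
    d-step {a} {b} {k} ab≡1+k with walk-of-length ab≡1+k
    ... | step {w = a′} aa′ rest = a′ , aa′≡1 , a′b≡k
      where
      aa′≡1 : d a a′ ≡ 1
      aa′≡1 = ≤-antisym (minimal (step aa′ here)) (n≢0⇒n>0 (distinct aa′))
      a′b≡k : d a′ b ≡ k
      a′b≡k = ≤-antisym (minimal rest) (≤-pred (begin
        suc k            ≡⟨ ab≡1+k ⟨
        d a b            ≤⟨ minimal (shortest a a′ ++ʷ shortest a′ b) ⟩
        d a a′ + d a′ b  ≡⟨ cong (_+ d a′ b) aa′≡1 ⟩
        suc (d a′ b)     ∎))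

    metric : GeodesicMetric (Fin n)
    metric = record
      { d          = d
      ; d-refl     = λ a → n≤0⇒n≡0 (minimal here)
      ; d-sym      = λ a b → ≤-antisym (minimal (reverseʷ (shortest b a))) (minimal (reverseʷ (shortest a b)))
      ; d-triangle = λ a b c → minimal (shortest a b ++ʷ shortest b c)
      ; d-step     = d-step
      }

    alpha-condition : ∀ {i} → AlphaMetric i G → AlphaCondition metric i
    alpha-condition α u v w x vw≡1 uw≡uv+1 vx≡1+wx =
      α u v w x (proj₂ (D u v)) (proj₂ (D v w)) (proj₂ (D u w)) (proj₂ (D v x)) (proj₂ (D w x)) (proj₂ (D u x))
        (adjacent vw≡1) (trans uw≡uv+1 (cong (d u v +_) (sym vw≡1))) (trans vx≡1+wx (cong (_+ d w x) (sym vw≡1)))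

    hyperbolic : ∀ {i} → AlphaMetric i G → HyperbolicTwice G (4 * slack i)
    hyperbolic {i} α u v w x Duv Dwx Duw Dvx Dux Dvw
      with refl ← d-unique Duv | refl ← d-unique Dwx | refl ← d-unique Duw
         | refl ← d-unique Dvx | refl ← d-unique Dux | refl ← d-unique Dvw =
      λ uv+wx≤uw+vx _ → AlphaGeometry.four-point metric i (alpha-condition α) (nearest-Fin metric) uv+wx≤uw+vx

alpha⇒hyperbolic : ∀ i G → AlphaMetric i G → HyperbolicTwice G (4 * slack i)
alpha⇒hyperbolic i G α u v w x Duv Dwx Duw Dvx Dux Dvw uv+wx≤uw+vx uw+vx≤ux+vw =
  decidable-stable (_ ≤? _) (¬¬-map
    (λ D → Table.hyperbolic D α u v w x Duv Dwx Duw Dvx Dux Dvw uv+wx≤uw+vx uw+vx≤ux+vw)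
    all-distances)
  where open ShortestPaths G

4*slack≤2*[8*[i+1]] : ∀ i → 4 * slack i ≤ 2 * (8 * (i + 1))
4*slack≤2*[8*[i+1]] i = ≤-trans (m≤m+n (4 * (3 * i + 2)) (4 * i + 8)) (≤-reflexive (solve (i ∷ [])))

corollary2 : Σ ℕ (λ C → (i : ℕ) → (G : Graph) → AlphaMetric i G →
               Σ ℕ (λ k → (k ≤ 2 * (C * (i + 1))) × HyperbolicTwice G k))
corollary2 = 8 , λ i G α → 4 * slack i , 4*slack≤2*[8*[i+1]] i , alpha⇒hyperbolic i G α
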